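{- In intensional Martin-Löf type theory with weak propositional truncation, for every type $X:\mathcal U$ there is a function $\lVert X\rVert\to\mathrm{Pop}(X)$, where $\mathrm{Pop}(X):\equiv\prod_{f:X\to X}\Big(\big(\prod_{x,y:X}f(x)=f(y)\big)\to\sum_{x:X}x=f(x)\Big)$.
   Context: Intensional Martin-Löf type theory with a universe $\mathcal U$, $\Sigma$, $\Pi$, $+$ and identity types (J only; no UIP/K). $\mathrm{isProp}(A):\equiv\prod_{a,b:A}a=b$. Weak propositional truncation: for every $A:\mathcal U$ a type $\lVert A\rVert:\mathcal U$ with $|{ - }|:A\to\lVert A\rVert$, a proof of $\mathrm{isProp}(\lVert A\rVert)$, and $\mathrm{rec}:\prod_{P:\mathcal U}\mathrm{isProp}(P)\to(A\to P)\to\lVert A\rVert\to P$ (no judgmental computation rule). $\mathrm{Pop}(X)$ ("$X$ is populated") says every weakly constant endomap on $X$ has a fixed point. -}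

{-# OPTIONS --without-K #-}
module Defs where

open import Level using (Level; suc)
open import Data.Product using (Σ; _,_)
open import Relation.Binary.PropositionalEquality using (_≡_)

isProp : ∀ {ℓ} → Set ℓ → Set ℓ
isProp A = (a b : A) → a ≡ b

wconst : ∀ {ℓ} {X : Set ℓ} → (X → X) → Set ℓ
wconst {X = X} f = (x y : X) → f x ≡ f y

Pop : ∀ {ℓ} → Set ℓ → Set ℓ
Pop X = (f : X → X) → wconst f → Σ X (λ x → x ≡ f x)

-- Weak propositional truncation on the universe Set ℓ:
-- no judgmental computation rule for rec.
record WeakTrunc (ℓ : Level) : Set (suc ℓ) where
  field
    ∥_∥      : Set ℓ → Set ℓ
    ∣_∣      : {A : Set ℓ} → A → ∥ A ∥
    ∥∥-isProp : {A : Set ℓ} → isProp ∥ A ∥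
    rec      : {A : Set ℓ} (P : Set ℓ) → isProp P → (A → P) → ∥ A ∥ → P

{-# OPTIONS --without-K #-}
module Submission where

-- The type of fixed points of a weakly constant endomap f is a proposition
-- (Kraus, Escardó, Coquand, Altenkirch).  Hence, to produce one from ∥ X ∥ it
-- suffices to produce one from a point x : X, and f x is a fixed point since
-- f x ≡ f (f x) by weak constancy.

open import Defs
open import Level using (Level)
open import Data.Product using (Σ; _,_)
open import Data.Product.Properties using (Σ-≡,≡→≡)
open import Relation.Binary.PropositionalEquality

Fix : ∀ {ℓ} {X : Set ℓ} → (X → X) → Set ℓ
Fix {X = X} f = Σ X (λ x → x ≡ f x)

subst-fixedPoint : ∀ {ℓ} {X : Set ℓ} (f : X → X) {x y : X} (e : x ≡ y) (p : x ≡ f x) →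
                   subst (λ z → z ≡ f z) e p ≡ trans (sym e) (trans p (cong f e))
subst-fixedPoint f refl p = sym (trans-reflʳ p)

cong-wconst : ∀ {ℓ} {X : Set ℓ} {f : X → X} (c : wconst f) {x y : X} (e : x ≡ y) →
              cong f e ≡ trans (sym (c x x)) (c x y)
cong-wconst c {x} refl = sym (trans-symˡ (c x x))

trans-cancel : ∀ {ℓ} {X : Set ℓ} {a b d g h : X}
               (p : a ≡ b) (k : d ≡ b) (m : d ≡ g) (q : h ≡ g) →
               trans (sym (trans p (trans (sym k) (trans m (sym q)))))
                     (trans p (trans (sym k) m))
               ≡ q
trans-cancel refl refl refl refl = refl

Fix-isProp : ∀ {ℓ} {X : Set ℓ} {f : X → X} → wconst f → isProp (Fix f)
Fix-isProp {f = f} c (x , p) (y , q) = Σ-≡,≡→≡ (e , transported)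
  where
  e : x ≡ y
  e = trans p (trans (sym (c x x)) (trans (c x y) (sym q)))

  transported : subst (λ z → z ≡ f z) e p ≡ q
  transported = begin
    subst (λ z → z ≡ f z) e p
      ≡⟨ subst-fixedPoint f e p ⟩
    trans (sym e) (trans p (cong f e))
      ≡⟨ cong (λ r → trans (sym e) (trans p r)) (cong-wconst c e) ⟩
    trans (sym e) (trans p (trans (sym (c x x)) (c x y)))
      ≡⟨ trans-cancel p (c x x) (c x y) q ⟩
    q ∎
    where open ≡-Reasoning

theorem6p2 : {ℓ : Level} (T : WeakTrunc ℓ) (X : Set ℓ) → WeakTrunc.∥_∥ T X → Pop X
theorem6p2 T X t f c = rec (Fix f) (Fix-isProp c) (λ x → f x , c x (f x)) t
  where open WeakTrunc T
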